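{- Let $a_1x_1+\cdots+a_nx_n\leqslant a_0$ be a linear integer constraint with positive integer coefficients and integer variables $x_i\in[0,d_i]$, let $\mathcal M$ be its MDD with root $\mu$, and let $F$ be the MDD encoding formula described in the context (including the unit clause $z_\mu$). Then unit propagation on $F$ is domain consistent for the constraint, in the following sense. Let $0\le l_i\le u_i\le d_i$ for each $i$ and let $A$ be the partial assignment setting $y_i^k$ true for $1\le k\le l_i$ and false for $u_i<k\le d_i$. (a) If no integer vector $(w_1,\dots,w_n)$ with $l_i\le w_i\le u_i$ for all $i$ satisfies the constraint, then unit propagation on $F\cup A$ derives a conflict. (b) If unit propagation on $F\cup A$ derives no conflict, then for every $i$ and every value $v\in[0,d_i]$ that is not excluded for $x_i$, there exists an integer solution $(w_1,\dots,w_n)$ of the constraint with $w_i=v$ and with each $w_j$ not excluded for $x_j$; here a value $w$ is excluded for $x_j$ if after unit propagation some $y_j^k$ with $1\le k\le w$ is false or some $y_j^k$ with $w<k\le d_j$ is true.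
   Context: The MDD of the constraint is the quasi-reduced ordered multi-valued decision diagram without long edges, with variable order $x_1,\dots,x_n$, representing the constraint: it has terminal nodes $\mathcal T$ (true) and $\mathcal F$ (false); each non-terminal node $\nu$ has a selector variable $x_i$ and children $\mathrm{child}(\nu,r)$, $0\le r\le d_i$, which have selector $x_{i+1}$ (or are terminals if $i=n$); the root $\mu$ has selector $x_1$ and represents the constraint. Order encoding: for each $i$ and $1\le k\le d_i$ a Boolean variable $y_i^k$ meaning $x_i\geqslant k$, with clauses $y_i^{k+1}\rightarrow y_i^k$; $y_i^0$ denotes the constant true. MDD encoding formula $F$: the order-encoding clauses, one Boolean variable $z_\nu$ per node $\nu$, the unit clauses $z_\mu$, $z_{\mathcal T}$ and $\neg z_{\mathcal F}$, and for every non-terminal node $\nu$ with selector $x_i$ and every $0\le j\le d_i$ the clause $\neg z_\nu\lor\neg y_i^j\lor z_{\mathrm{child}(\nu,j)}$. -}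

module Defs where

open import Data.Nat using (ℕ; zero; suc; _+_; _*_; _≤_; _<_)
open import Data.Integer using (ℤ; +_) renaming (_≤_ to _≤ℤ_)
open import Data.Fin using (Fin; zero; suc; toℕ)
open import Data.List using (List; []; _∷_)
open import Data.List.Membership.Propositional using (_∈_)
open import Data.Product using (Σ; _×_; ∃)
open import Data.Sum using (_⊎_)
open import Function.Bundles using (_⇔_)
open import Relation.Binary.PropositionalEquality using (_≡_; _≢_)
open import Relation.Nullary using (¬_)

-- The linear constraint  a₁x₁ + ⋯ + aₙxₙ ≤ a₀
-- Variables are indexed 0-based by Fin n (index i stands for x_{i+1}).

sumFin : ∀ {n} → (Fin n → ℕ) → ℕ
sumFin {zero}  f = 0
sumFin {suc n} f = f zero + sumFin (λ i → f (suc i))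

Sat : ∀ {n} → (a : Fin n → ℕ) → (a₀ : ℤ) → (w : Fin n → ℕ) → Set
Sat a a₀ w = + (sumFin (λ i → a i * w i)) ≤ℤ a₀

data Node (m : ℕ) : Set where
  T F   : Node m
  inner : Fin m → Node m

record MDD (n : ℕ) (d : Fin n → ℕ) : Set where
  field
    size  : ℕ
    sel   : Fin size → Fin n
    child : (ν : Fin size) → Fin (suc (d (sel ν))) → Node size
    root  : Node size

module _ {n : ℕ} {d : Fin n → ℕ} (M : MDD n d) where
  open MDD M

  level : Node size → ℕ
  level T         = n
  level F         = n
  level (inner ν) = toℕ (sel ν)

  data Leads (w : (i : Fin n) → Fin (suc (d i))) : Node size → Set where
    leadsT : Leads w T
    step   : ∀ ν → Leads w (child ν (w (sel ν))) → Leads w (inner ν)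

  data Reachable : Node size → Set where
    reachRoot  : Reachable root
    reachChild : ∀ ν r → Reachable (inner ν) → Reachable (child ν r)

  record IsMDDOf (a : Fin n → ℕ) (a₀ : ℤ) : Set where
    field
      rootLevel    : level root ≡ 0
      childLevel   : ∀ ν r → level (child ν r) ≡ suc (toℕ (sel ν))
      represents   : ∀ w → Leads w root ⇔ Sat a a₀ (λ i → toℕ (w i))
      allReachable : ∀ ν → Reachable (inner ν)
      quasiReduced : ∀ ν ν' → sel ν ≡ sel ν' →
                     (∀ w → Leads w (inner ν) ⇔ Leads w (inner ν')) → ν ≡ ν'

-- y i k  stands for  y_{i}^{toℕ k + 1}  i.e.  "x_i ≥ toℕ k + 1"  (1 ≤ k ≤ dᵢ);
-- z ν    stands for  z_ν
data Var {n : ℕ} (d : Fin n → ℕ) (m : ℕ) : Set where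
  y : (i : Fin n) → Fin (d i) → Var d m
  z : Node m → Var d m

data Lit {n : ℕ} (d : Fin n → ℕ) (m : ℕ) : Set where
  pos neg : Var d m → Lit d m

negate : ∀ {n} {d : Fin n → ℕ} {m} → Lit d m → Lit d m
negate (pos v) = neg v
negate (neg v) = pos v

module _ {n : ℕ} {d : Fin n → ℕ} (M : MDD n d) where
  open MDD M

  Clause : Set
  Clause = List (Lit d size)

  data InF : Clause → Set where
    order  : ∀ i (k k' : Fin (d i)) → toℕ k' ≡ suc (toℕ k) →
             InF (neg (y i k') ∷ pos (y i k) ∷ [])
    unitμ  : InF (pos (z root) ∷ [])
    unitT  : InF (pos (z T) ∷ [])
    unitF  : InF (neg (z F) ∷ [])
    -- ¬z_ν ∨ ¬y_i^0 ∨ z_child(ν,0), with y_i^0 the constant true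
    edge0  : ∀ ν → InF (neg (z (inner ν)) ∷ pos (z (child ν zero)) ∷ [])
    edge   : ∀ ν (k : Fin (d (sel ν))) →
             InF (neg (z (inner ν)) ∷ neg (y (sel ν) k) ∷ pos (z (child ν (suc k))) ∷ [])

  module _ (l u : Fin n → ℕ) where
    data InA : Clause → Set where
      lower : ∀ i (k : Fin (d i)) → toℕ k < l i → InA (pos (y i k) ∷ [])
      upper : ∀ i (k : Fin (d i)) → u i ≤ toℕ k → InA (neg (y i k) ∷ [])

    InFA : Clause → Set
    InFA C = InF C ⊎ InA C

    data UP : Lit d size → Set where
      unit : ∀ {C l} → InFA C → l ∈ C →
             (∀ {l'} → l' ∈ C → l' ≢ l → UP (negate l')) → UP l

    Conflict : Set
    Conflict = Σ Clause λ C → InFA C × (∀ {l'} → l' ∈ C → UP (negate l'))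

    Excluded : Fin n → ℕ → Set
    Excluded j w = Σ (Fin (d j)) λ k →
      (toℕ k < w × UP (neg (y j k))) ⊎ (w ≤ toℕ k × UP (pos (y j k)))

-- Let w agree with the lower bounds l everywhere except possibly at xᵢ.  If w
-- violates the constraint, its path in the MDD ends in F.  Propagating from z_μ
-- down the edges labelled lⱼ (whose y-literals are all set by A) makes z true on
-- the path up to the node ν with selector xᵢ; propagating from ¬z_F up the same
-- edges makes z false on the path below ν.  The clause
-- ¬z_ν ∨ ¬yᵢ^{wᵢ} ∨ z_child(ν,wᵢ) then falsifies yᵢ^{wᵢ}, i.e. excludes wᵢ, or
-- is a conflict when wᵢ = 0.  With w = l there is no such ν, so a violation of l
-- gives a conflict, which is part (a); part (b) takes w = l[i ≔ v].
module Submission where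

open import Defs
open import Data.Nat using (ℕ; zero; suc; _+_; _*_; _≤_; _<_; s≤s; _≤?_)
open import Data.Nat.Properties
  using (≤-refl; ≤-trans; ≤-reflexive; <-trans; <-irrefl; n<1+n; m≤n⇒m≤1+n; ≰⇒>; <⇒≱; +-suc; +-identityʳ)
open import Data.Integer using (ℤ)
import Data.Integer as Int
open import Data.Fin using (Fin; toℕ; fromℕ<; _≟_) renaming (zero to fzero; suc to fsuc)
open import Data.Fin.Properties using (toℕ<n; toℕ-fromℕ<)
open import Data.Vec.Functional using (updateAt)
open import Data.Vec.Functional.Properties using (updateAt-updates; updateAt-minimal)
open import Data.List using ([]; _∷_)
open import Data.List.Relation.Unary.Any using (here; there)
open import Data.Product using (Σ; _×_; _,_)
open import Data.Sum using (_⊎_; inj₁; inj₂)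
open import Data.Empty using (⊥-elim)
open import Function using (const)
open import Function.Bundles using (Equivalence)
open import Relation.Binary.PropositionalEquality
  using (_≡_; _≢_; refl; sym; trans; cong; cong₂; subst)
open import Relation.Nullary using (¬_; yes; no)

sumFin-cong : ∀ {n} {f g : Fin n → ℕ} → (∀ i → f i ≡ g i) → sumFin f ≡ sumFin g
sumFin-cong {zero}  f≗g = refl
sumFin-cong {suc n} f≗g = cong₂ _+_ (f≗g fzero) (sumFin-cong (λ i → f≗g (fsuc i)))

updateAt-elim : ∀ {A : Set} {n} (P : Fin n → A → Set) (xs : Fin n → A) (i : Fin n) {f : A → A} →
                P i (f (xs i)) → (∀ j → j ≢ i → P j (xs j)) → ∀ j → P j (updateAt xs i f j)
updateAt-elim P xs i Pi Pj j with j ≟ i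
... | yes refl = subst (P i) (sym (updateAt-updates i xs)) Pi
... | no j≢i   = subst (P j) (sym (updateAt-minimal j i xs j≢i)) (Pj j j≢i)

module _ {n : ℕ} {d : Fin n → ℕ} (M : MDD n d) where
  open MDD M

  data LeadsF (w : (i : Fin n) → Fin (suc (d i))) : Node size → Set where
    leadsF : LeadsF w F
    stepF  : ∀ ν → LeadsF w (child ν (w (sel ν))) → LeadsF w (inner ν)

  asFin : (w : Fin n → ℕ) → (∀ j → w j ≤ d j) → (j : Fin n) → Fin (suc (d j))
  asFin w w≤d j = fromℕ< (s≤s (w≤d j))

  toℕ-asFin : ∀ w (w≤d : ∀ j → w j ≤ d j) j → toℕ (asFin w w≤d j) ≡ w j
  toℕ-asFin w w≤d j = toℕ-fromℕ< (s≤s (w≤d j))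

  module _ {a : Fin n → ℕ} {a₀ : ℤ} (isM : IsMDDOf M a a₀) where
    open IsMDDOf isM

    -- k, the number of levels below N, is the termination measure.
    Leads⊎LeadsF : ∀ w k N → k + level M N ≡ n → Leads M w N ⊎ LeadsF w N
    Leads⊎LeadsF w k       T         _ = inj₁ leadsT
    Leads⊎LeadsF w k       F         _ = inj₂ leadsF
    Leads⊎LeadsF w zero    (inner ν) e = ⊥-elim (<-irrefl e (toℕ<n (sel ν)))
    Leads⊎LeadsF w (suc k) (inner ν) e
      with Leads⊎LeadsF w k (child ν (w (sel ν)))
             (trans (cong (k +_) (childLevel ν (w (sel ν)))) (trans (+-suc k _) e))
    ... | inj₁ p = inj₁ (step ν p)
    ... | inj₂ p = inj₂ (stepF ν p)

    unsat⇒LeadsF-root : ∀ w (w≤d : ∀ j → w j ≤ d j) → ¬ Sat a a₀ w → LeadsF (asFin w w≤d) root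
    unsat⇒LeadsF-root w w≤d unsat
      with Leads⊎LeadsF (asFin w w≤d) n root (trans (cong (n +_) rootLevel) (+-identityʳ n))
    ... | inj₂ p = p
    ... | inj₁ p = ⊥-elim (unsat (subst (λ s → Int.+ s Int.≤ a₀) sum-asFin (Equivalence.to (represents _) p)))
      where
      sum-asFin : sumFin (λ j → a j * toℕ (asFin w w≤d j)) ≡ sumFin (λ j → a j * w j)
      sum-asFin = sumFin-cong (λ j → cong (a j *_) (toℕ-asFin w w≤d j))

  module _ (l u : Fin n → ℕ) where
    propagate₁ : ∀ {x} → InFA M l u (x ∷ []) → UP M l u x
    propagate₁ C = unit C (here refl) λ { (here refl) x≢x → ⊥-elim (x≢x refl) ; (there ()) _ }

    propagate₂ˡ : ∀ {x₁ x₂} → InFA M l u (x₁ ∷ x₂ ∷ []) → UP M l u (negate x₂) → UP M l u x₁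
    propagate₂ˡ C h₂ = unit C (here refl)
      λ { (here refl) x≢x → ⊥-elim (x≢x refl) ; (there (here refl)) _ → h₂ ; (there (there ())) _ }

    propagate₂ʳ : ∀ {x₁ x₂} → InFA M l u (x₁ ∷ x₂ ∷ []) → UP M l u (negate x₁) → UP M l u x₂
    propagate₂ʳ C h₁ = unit C (there (here refl))
      λ { (here refl) _ → h₁ ; (there (here refl)) x≢x → ⊥-elim (x≢x refl) ; (there (there ())) _ }

    propagate₃ˡ : ∀ {x₁ x₂ x₃} → InFA M l u (x₁ ∷ x₂ ∷ x₃ ∷ []) →
                  UP M l u (negate x₂) → UP M l u (negate x₃) → UP M l u x₁
    propagate₃ˡ C h₂ h₃ = unit C (here refl)
      λ { (here refl) x≢x → ⊥-elim (x≢x refl) ; (there (here refl)) _ → h₂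
        ; (there (there (here refl))) _ → h₃ ; (there (there (there ()))) _ }

    propagate₃ᵐ : ∀ {x₁ x₂ x₃} → InFA M l u (x₁ ∷ x₂ ∷ x₃ ∷ []) →
                  UP M l u (negate x₁) → UP M l u (negate x₃) → UP M l u x₂
    propagate₃ᵐ C h₁ h₃ = unit C (there (here refl))
      λ { (here refl) _ → h₁ ; (there (here refl)) x≢x → ⊥-elim (x≢x refl)
        ; (there (there (here refl))) _ → h₃ ; (there (there (there ()))) _ }

    propagate₃ʳ : ∀ {x₁ x₂ x₃} → InFA M l u (x₁ ∷ x₂ ∷ x₃ ∷ []) →
                  UP M l u (negate x₁) → UP M l u (negate x₂) → UP M l u x₃
    propagate₃ʳ C h₁ h₂ = unit C (there (there (here refl)))
      λ { (here refl) _ → h₁ ; (there (here refl)) _ → h₂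
        ; (there (there (here refl))) x≢x → ⊥-elim (x≢x refl) ; (there (there (there ()))) _ }

    conflict₁ : ∀ {x} → InFA M l u (x ∷ []) → UP M l u (negate x) → Conflict M l u
    conflict₁ C h = _ , C , λ { (here refl) → h ; (there ()) }

    conflict₂ : ∀ {x₁ x₂} → InFA M l u (x₁ ∷ x₂ ∷ []) →
                UP M l u (negate x₁) → UP M l u (negate x₂) → Conflict M l u
    conflict₂ C h₁ h₂ = _ , C , λ { (here refl) → h₁ ; (there (here refl)) → h₂ ; (there (there ())) }

    UP-lower : ∀ {j k} → toℕ k < l j → UP M l u (pos (y j k))
    UP-lower k<l = propagate₁ (inj₂ (lower _ _ k<l))

    -- Only the lower-bound units and the order clauses can set a y-literal true.
    UP-pos-y⇒<l : ∀ {j k} → UP M l u (pos (y j k)) → toℕ k < l j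
    UP-pos-y⇒<l (unit (inj₂ (lower j k k<l)) (here refl) _) = k<l
    UP-pos-y⇒<l (unit (inj₂ (lower j k _)) (there ()) _)
    UP-pos-y⇒<l (unit (inj₂ (upper j k _)) (here ()) _)
    UP-pos-y⇒<l (unit (inj₂ (upper j k _)) (there ()) _)
    UP-pos-y⇒<l (unit (inj₁ (order j k k′ k′≡1+k)) (there (here refl)) others) =
      <-trans (n<1+n (toℕ k))
              (subst (_< l j) k′≡1+k (UP-pos-y⇒<l (others (here refl) λ ())))
    UP-pos-y⇒<l (unit (inj₁ (order j k k′ _)) (here ()) _)
    UP-pos-y⇒<l (unit (inj₁ (order j k k′ _)) (there (there ())) _)
    UP-pos-y⇒<l (unit (inj₁ unitμ) (here ()) _)
    UP-pos-y⇒<l (unit (inj₁ unitμ) (there ()) _)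
    UP-pos-y⇒<l (unit (inj₁ unitT) (here ()) _)
    UP-pos-y⇒<l (unit (inj₁ unitT) (there ()) _)
    UP-pos-y⇒<l (unit (inj₁ unitF) (here ()) _)
    UP-pos-y⇒<l (unit (inj₁ unitF) (there ()) _)
    UP-pos-y⇒<l (unit (inj₁ (edge0 ν)) (here ()) _)
    UP-pos-y⇒<l (unit (inj₁ (edge0 ν)) (there (here ())) _)
    UP-pos-y⇒<l (unit (inj₁ (edge0 ν)) (there (there ())) _)
    UP-pos-y⇒<l (unit (inj₁ (edge ν k)) (here ()) _)
    UP-pos-y⇒<l (unit (inj₁ (edge ν k)) (there (here ())) _)
    UP-pos-y⇒<l (unit (inj₁ (edge ν k)) (there (there (here ()))) _)
    UP-pos-y⇒<l (unit (inj₁ (edge ν k)) (there (there (there ()))) _)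

    ¬Conflict⇒¬Excluded-l : ¬ Conflict M l u → ∀ j → ¬ Excluded M l u j (l j)
    ¬Conflict⇒¬Excluded-l ¬conflict j (k , inj₁ (k<l , ¬yₖ)) = ¬conflict (conflict₁ (inj₂ (lower j k k<l)) ¬yₖ)
    ¬Conflict⇒¬Excluded-l ¬conflict j (k , inj₂ (l≤k , yₖ)) = <⇒≱ (UP-pos-y⇒<l yₖ) l≤k

    UP-z-child : ∀ ν r → toℕ r ≤ l (sel ν) →
                 UP M l u (pos (z (inner ν))) → UP M l u (pos (z (child ν r)))
    UP-z-child ν fzero    _   zν = propagate₂ʳ (inj₁ (edge0 ν)) zν
    UP-z-child ν (fsuc k) k<l zν = propagate₃ʳ (inj₁ (edge ν k)) zν (UP-lower k<l)

    UP-¬z-parent : ∀ ν r → toℕ r ≤ l (sel ν) →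
                   UP M l u (neg (z (child ν r))) → UP M l u (neg (z (inner ν)))
    UP-¬z-parent ν fzero    _   ¬zc = propagate₂ˡ (inj₁ (edge0 ν)) ¬zc
    UP-¬z-parent ν (fsuc k) k<l ¬zc = propagate₃ˡ (inj₁ (edge ν k)) (UP-lower k<l) ¬zc

    UP-edge : ∀ ν r → UP M l u (pos (z (inner ν))) → UP M l u (neg (z (child ν r))) →
              Conflict M l u ⊎ Excluded M l u (sel ν) (toℕ r)
    UP-edge ν fzero    zν ¬zc = inj₁ (conflict₂ (inj₁ (edge0 ν)) zν ¬zc)
    UP-edge ν (fsuc k) zν ¬zc = inj₂ (k , inj₁ (n<1+n (toℕ k) , propagate₃ᵐ (inj₁ (edge ν k)) zν ¬zc))

    module _ {a : Fin n → ℕ} {a₀ : ℤ} (isM : IsMDDOf M a a₀) where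
      open IsMDDOf isM

      module _ (w : (i : Fin n) → Fin (suc (d i))) where

        record Departure : Set where
          field
            node         : Fin size
            z-node       : UP M l u (pos (z (inner node)))
            child-leadsF : LeadsF w (child node (w (sel node)))
            above-l      : l (sel node) < toℕ (w (sel node))

        z-propagates-down : ∀ {N} → UP M l u (pos (z N)) → LeadsF w N → Conflict M l u ⊎ Departure
        z-propagates-down zF leadsF = inj₁ (conflict₁ (inj₁ unitF) zF)
        z-propagates-down zν (stepF ν p) with toℕ (w (sel ν)) ≤? l (sel ν)
        ... | yes w≤l = z-propagates-down (UP-z-child ν _ w≤l zν) p
        ... | no  w≰l = inj₂ (record { node = ν ; z-node = zν ; child-leadsF = p ; above-l = ≰⇒> w≰l })

        ¬z-propagates-up : ∀ {m N} → (∀ j → m ≤ toℕ j → toℕ (w j) ≤ l j) → m ≤ level M N →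
                           LeadsF w N → UP M l u (neg (z N))
        ¬z-propagates-up     w≤l m≤N leadsF      = propagate₁ (inj₁ unitF)
        ¬z-propagates-up {m} w≤l m≤N (stepF ν p) =
          UP-¬z-parent ν _ (w≤l (sel ν) m≤N) (¬z-propagates-up w≤l m≤child p)
          where
          m≤child : m ≤ level M (child ν (w (sel ν)))
          m≤child = subst (m ≤_) (sym (childLevel ν (w (sel ν)))) (m≤n⇒m≤1+n m≤N)

        LeadsF-root⇒Conflict⊎Excluded : ∀ i → (∀ j → j ≢ i → toℕ (w j) ≤ l j) → LeadsF w root →
                                         Conflict M l u ⊎ Excluded M l u i (toℕ (w i))
        LeadsF-root⇒Conflict⊎Excluded i w≤l p with z-propagates-down (propagate₁ (inj₁ unitμ)) p
        ... | inj₁ conflict = inj₁ conflict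
        ... | inj₂ δ with sel (Departure.node δ) ≟ i
        ...   | no  sel≢i = ⊥-elim (<⇒≱ (Departure.above-l δ) (w≤l _ sel≢i))
        ...   | yes refl  = UP-edge ν (w (sel ν)) (Departure.z-node δ)
                              (¬z-propagates-up below-ν (≤-reflexive (sym (childLevel ν _)))
                                                (Departure.child-leadsF δ))
          where
          ν : Fin size
          ν = Departure.node δ
          below-ν : ∀ j → suc (toℕ (sel ν)) ≤ toℕ j → toℕ (w j) ≤ l j
          below-ν j ν<j = w≤l j λ { refl → <-irrefl refl ν<j }

      unsat-l⇒Conflict : (l≤d : ∀ j → l j ≤ d j) → ¬ Sat a a₀ l → Conflict M l u
      unsat-l⇒Conflict l≤d unsat
        with z-propagates-down (asFin l l≤d) (propagate₁ (inj₁ unitμ)) (unsat⇒LeadsF-root isM l l≤d unsat)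
      ... | inj₁ conflict = conflict
      ... | inj₂ δ = ⊥-elim (<-irrefl (sym (toℕ-asFin l l≤d _)) (Departure.above-l δ))

      Support : Fin n → ℕ → Set
      Support i v = Σ (Fin n → ℕ) λ w → (∀ j → w j ≤ d j) × Sat a a₀ w × w i ≡ v ×
                      (∀ j → ¬ Excluded M l u j (w j))

      ¬Conflict⇒Support : (∀ j → l j ≤ d j) → ¬ Conflict M l u →
                          ∀ i v → v ≤ d i → ¬ Excluded M l u i v → Support i v
      ¬Conflict⇒Support l≤d ¬conflict i v v≤d ¬excluded = w , w≤d , sat , updateAt-updates i l , ¬excludedʷ
        where
        w : Fin n → ℕ
        w = updateAt l i (const v)
        w≤d : ∀ j → w j ≤ d j
        w≤d = updateAt-elim (λ j x → x ≤ d j) l i v≤d (λ j _ → l≤d j)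
        ¬excludedʷ : ∀ j → ¬ Excluded M l u j (w j)
        ¬excludedʷ = updateAt-elim (λ j x → ¬ Excluded M l u j x) l i ¬excluded
                       (λ j _ → ¬Conflict⇒¬Excluded-l ¬conflict j)
        sat : Sat a a₀ w
        sat with Int.+ (sumFin (λ j → a j * w j)) Int.≤? a₀
        ... | yes s = s
        ... | no unsat
          with LeadsF-root⇒Conflict⊎Excluded (asFin w w≤d) i
                 (λ j j≢i → ≤-reflexive (trans (toℕ-asFin w w≤d j) (updateAt-minimal j i l j≢i)))
                 (unsat⇒LeadsF-root isM w w≤d unsat)
        ... | inj₁ conflict = ⊥-elim (¬conflict conflict)
        ... | inj₂ excluded = ⊥-elim (¬excluded (subst (Excluded M l u i)
                                (trans (toℕ-asFin w w≤d i) (updateAt-updates i l)) excluded))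

theorem5 : ∀ {n} (d : Fin n → ℕ) (a : Fin n → ℕ) (a₀ : ℤ) → (∀ i → 0 < a i) →
           (M : MDD n d) → IsMDDOf M a a₀ →
           (l u : Fin n → ℕ) → (∀ i → l i ≤ u i) → (∀ i → u i ≤ d i) →
           (((w : Fin n → ℕ) → (∀ i → l i ≤ w i × w i ≤ u i) → ¬ Sat a a₀ w) →
              Conflict M l u)
           × (¬ Conflict M l u →
              ∀ i v → v ≤ d i → ¬ Excluded M l u i v →
              Σ (Fin n → ℕ) λ w → (∀ j → w j ≤ d j) × Sat a a₀ w × w i ≡ v ×
                (∀ j → ¬ Excluded M l u j (w j)))
theorem5 d a a₀ _ M isM l u l≤u u≤d =
  (λ noSolution → unsat-l⇒Conflict M l u isM l≤d (noSolution l λ j → ≤-refl , l≤u j)) ,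
  ¬Conflict⇒Support M l u isM l≤d
  where
  l≤d : ∀ j → l j ≤ d j
  l≤d j = ≤-trans (l≤u j) (u≤d j)
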